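{- Let $a_{k,n}$ denote the entries of the binomial array $B(1-x)$, so $a_{k,n}=\binom{n}{k}-\binom{n}{k-1}$. For every integer $n\ge0$, the sum of squares of the entries of column $n$ is $2C_n$, i.e. $\sum_{i=0}^{n+1}a_{i,n}^2=2C_n$; equivalently $$C_n=\sum_{i=0}^{\lfloor n/2\rfloor}a_{i,n}^2,$$ and for all $l\in\mathbb{Z}$, $$C_n=-\frac12\sum_{i=0}^{n+1}a_{i,n-l}\,a_{n+1-i,n+l}.$$ Here $C_n=\frac{1}{n+1}\binom{2n}{n}$ is the $n$-th Catalan number.
   Context: The binomial array $B(p(x))$ has entries $a_{k,n}$ ($k\ge0$, $n\in\mathbb{Z}$) equal to the coefficient of $x^k$ in $(1+x)^np(x)$, where for $n<0$, $(1+x)^n$ is the inverse power series. Binomial coefficients with negative upper index are $\binom{n}{k}=(-1)^k\binom{ -n+k-1}{k}$ for $n<0,k\ge0$, and $\binom{n}{k}=0$ for $k<0$. -}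

module Defs where

open import Data.Nat as ℕ using (ℕ; zero; suc)
open import Data.Nat.Combinatorics using (_C_)
open import Data.Nat.DivMod using (_/_)
open import Data.Integer as ℤ using (ℤ; +_; -[1+_]; _+_; _*_; -_; _^_)
open import Data.List using (List; []; _∷_)

-- Generalised binomial coefficient  binom n k  for n ∈ ℤ, k ≥ 0:
--   n ≥ 0 : the usual n choose k
--   n < 0 : (-1)^k * binom(-n+k-1, k);  for n = -(m+1) this is (-1)^k * (m+k choose k)
binomZ : ℤ → ℕ → ℤ
binomZ (+ n)    k = + (n C k)
binomZ -[1+ m ] k = (- (+ 1)) ^ k * + ((m ℕ.+ k) C k)

coeff : List ℤ → ℕ → ℤ
coeff []       j       = + 0
coeff (c ∷ cs) zero    = c
coeff (c ∷ cs) (suc j) = coeff cs j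

sumTo : ℕ → (ℕ → ℤ) → ℤ
sumTo zero    f = f 0
sumTo (suc n) f = sumTo n f + f (suc n)

-- Binomial array B(p): entry (k, n) is the coefficient of x^k in (1+x)^n p(x),
-- i.e. Σ_{j=0}^{k} p_j * binom(n, k-j).
binArray : List ℤ → ℕ → ℤ → ℤ
binArray p k n = sumTo k (λ j → coeff p j * binomZ n (k ℕ.∸ j))

a : ℕ → ℤ → ℤ
a k n = binArray (+ 1 ∷ - (+ 1) ∷ []) k n

catalan : ℕ → ℕ
catalan n = ((2 ℕ.* n) C n) / suc n

{-# OPTIONS --safe #-}
-- Column z of B(1 - x) is the power series (1 - x)(1 + x)^z, so by Vandermonde's identity for
-- integer exponents the convolution of columns x and y is (1 - x)^2 (1 + x)^(x + y).  For
-- x + y = 2n its coefficient of x^(n+1) is 2 (C(2n, n+1) - C(2n, n)) = -2 C_n.  Column n is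
-- antisymmetric, a (n+1-i) n = - a i n, which turns its convolution with itself into minus its sum
-- of squares, and makes that sum twice the sum over the first half.
module Submission where

open import Defs
open import Data.Nat as ℕ using (ℕ; _/_; zero; suc; _≤_; z≤n; s≤s; _∸_)
open import Data.Integer as ℤ using (ℤ; +_; _+_; _-_; _*_; -_; -[1+_]; _^_)
open import Data.Product using (_×_; _,_)
open import Relation.Binary.PropositionalEquality
  using (_≡_; refl; sym; trans; cong; cong₂; subst; _≗_; module ≡-Reasoning)

import Data.Nat.Properties as ℕP
open import Data.Nat.Combinatorics using (_C_; nCn≡1; nC1≡n; nCk+nC[k+1]≡[n+1]C[k+1]; nCk≡nC[n∸k]; k>n⇒nCk≡0)
open import Data.Nat.DivMod using (m*n/n≡m; m/n≡1+[m∸n]/n)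
import Data.Nat.Tactic.RingSolver as ℕSolver
import Data.Integer.Properties as ℤP
open import Data.Integer.Tactic.RingSolver using (solve-∀)
open import Data.List using ([]; _∷_)
open import Data.Sum using (_⊎_; inj₁; inj₂)
open import Function using (_∘_)

open ≡-Reasoning

sumTo-cong≤ : ∀ n {f g : ℕ → ℤ} → (∀ i → i ≤ n → f i ≡ g i) → sumTo n f ≡ sumTo n g
sumTo-cong≤ zero    f≡g = f≡g 0 z≤n
sumTo-cong≤ (suc n) f≡g =
  cong₂ _+_ (sumTo-cong≤ n (λ i i≤n → f≡g i (ℕP.m≤n⇒m≤1+n i≤n))) (f≡g (suc n) ℕP.≤-refl)

sumTo-cong : ∀ n {f g : ℕ → ℤ} → f ≗ g → sumTo n f ≡ sumTo n g
sumTo-cong n f≗g = sumTo-cong≤ n (λ i _ → f≗g i)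

sumTo-head : ∀ n (f : ℕ → ℤ) → sumTo (suc n) f ≡ f 0 + sumTo n (f ∘ suc)
sumTo-head zero    f = refl
sumTo-head (suc n) f = trans (cong (_+ f (suc (suc n))) (sumTo-head n f)) (ℤP.+-assoc (f 0) _ _)

sumTo-split : ∀ p q (f : ℕ → ℤ) →
              sumTo (p ℕ.+ suc q) f ≡ sumTo p f + sumTo q (λ j → f (suc p ℕ.+ j))
sumTo-split zero    q f = sumTo-head q f
sumTo-split (suc p) q f = begin
  sumTo (suc (p ℕ.+ suc q)) f                              ≡⟨ sumTo-head (p ℕ.+ suc q) f ⟩
  f 0 + sumTo (p ℕ.+ suc q) (f ∘ suc)                      ≡⟨ cong (_+_ (f 0)) (sumTo-split p q (f ∘ suc)) ⟩
  f 0 + (sumTo p (f ∘ suc) + tail)                         ≡⟨ ℤP.+-assoc (f 0) _ tail ⟨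
  f 0 + sumTo p (f ∘ suc) + tail                           ≡⟨ cong (_+ tail) (sumTo-head p f) ⟨
  sumTo (suc p) f + tail                                   ∎
  where tail = sumTo q (λ j → f (suc (suc p) ℕ.+ j))

sumTo-reverse : ∀ n (f : ℕ → ℤ) → sumTo n (λ i → f (n ∸ i)) ≡ sumTo n f
sumTo-reverse zero    f = refl
sumTo-reverse (suc n) f = begin
  sumTo (suc n) (λ i → f (suc n ∸ i))  ≡⟨ sumTo-head n _ ⟩
  f (suc n) + sumTo n (λ i → f (n ∸ i)) ≡⟨ cong (_+_ (f (suc n))) (sumTo-reverse n f) ⟩
  f (suc n) + sumTo n f                 ≡⟨ ℤP.+-comm (f (suc n)) (sumTo n f) ⟩
  sumTo (suc n) f                       ∎

sumTo-linear : ∀ n c d (f g : ℕ → ℤ) →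
               sumTo n (λ i → c * f i + d * g i) ≡ c * sumTo n f + d * sumTo n g
sumTo-linear zero    c d f g = refl
sumTo-linear (suc n) c d f g = begin
  sumTo n (λ i → c * f i + d * g i) + (c * f (suc n) + d * g (suc n))
    ≡⟨ cong (_+ (c * f (suc n) + d * g (suc n))) (sumTo-linear n c d f g) ⟩
  c * sumTo n f + d * sumTo n g + (c * f (suc n) + d * g (suc n))
    ≡⟨ regroup c d (sumTo n f) (sumTo n g) (f (suc n)) (g (suc n)) ⟩
  c * (sumTo n f + f (suc n)) + d * (sumTo n g + g (suc n)) ∎
  where
  regroup : ∀ c d s t x y → c * s + d * t + (c * x + d * y) ≡ c * (s + x) + d * (t + y)
  regroup = solve-∀

sumTo-neg : ∀ n (f : ℕ → ℤ) → sumTo n (λ i → - f i) ≡ - sumTo n f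
sumTo-neg zero    f = refl
sumTo-neg (suc n) f =
  trans (cong (_+ - f (suc n)) (sumTo-neg n f)) (sym (ℤP.neg-distrib-+ (sumTo n f) (f (suc n))))

sumTo-zero : ∀ n → sumTo n (λ _ → + 0) ≡ + 0
sumTo-zero zero    = refl
sumTo-zero (suc n) = cong (_+ + 0) (sumTo-zero n)

Palindromic : ℕ → (ℕ → ℤ) → Set
Palindromic N f = ∀ i → i ≤ N → f (N ∸ i) ≡ f i

Antipalindromic : ℕ → (ℕ → ℤ) → Set
Antipalindromic N g = ∀ i → i ≤ N → g (N ∸ i) ≡ - g i

sumTo-mirrored-tail : ∀ p q (f : ℕ → ℤ) → Palindromic (p ℕ.+ q) f →
                      sumTo q (λ j → f (p ℕ.+ j)) ≡ sumTo q f
sumTo-mirrored-tail p q f pal = begin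
  sumTo q (λ j → f (p ℕ.+ j))  ≡⟨ sumTo-cong≤ q mirror ⟩
  sumTo q (λ j → f (q ∸ j))    ≡⟨ sumTo-reverse q f ⟩
  sumTo q f                    ∎
  where
  mirror : ∀ j → j ≤ q → f (p ℕ.+ j) ≡ f (q ∸ j)
  mirror j j≤q = trans (sym (pal (p ℕ.+ j) (ℕP.+-monoʳ-≤ p j≤q)))
                       (cong f (ℕP.[m+n]∸[m+o]≡n∸o p q j))

i+i≡2*i : ∀ x → x + x ≡ + 2 * x
i+i≡2*i = solve-∀

sumTo-palindromic-odd : ∀ m (f : ℕ → ℤ) → Palindromic (suc (m ℕ.+ m)) f →
                        sumTo (suc (m ℕ.+ m)) f ≡ + 2 * sumTo m f
sumTo-palindromic-odd m f pal = begin
  sumTo (suc (m ℕ.+ m)) f                          ≡⟨ cong (λ N → sumTo N f) (ℕP.+-suc m m) ⟨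
  sumTo (m ℕ.+ suc m) f                            ≡⟨ sumTo-split m m f ⟩
  sumTo m f + sumTo m (λ j → f (suc m ℕ.+ j))      ≡⟨ cong (_+_ (sumTo m f)) (sumTo-mirrored-tail (suc m) m f pal) ⟩
  sumTo m f + sumTo m f                            ≡⟨ i+i≡2*i (sumTo m f) ⟩
  + 2 * sumTo m f                                  ∎

sumTo-palindromic-even : ∀ m (f : ℕ → ℤ) → Palindromic (suc (suc (m ℕ.+ m))) f → f (suc m) ≡ + 0 →
                         sumTo (suc (suc (m ℕ.+ m))) f ≡ + 2 * sumTo m f
sumTo-palindromic-even m f pal middle≡0 = begin
  sumTo (suc (suc (m ℕ.+ m))) f                          ≡⟨ cong (λ N → sumTo N f) N≡m+[2+m] ⟩
  sumTo (m ℕ.+ suc (suc m)) f                            ≡⟨ sumTo-split m (suc m) f ⟩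
  sumTo m f + sumTo (suc m) (λ j → f (suc m ℕ.+ j))      ≡⟨ cong (_+_ (sumTo m f)) (sumTo-head m _) ⟩
  sumTo m f + (f (suc m ℕ.+ 0) + upper)                  ≡⟨ cong (λ x → sumTo m f + (x + upper)) middle ⟩
  sumTo m f + (+ 0 + upper)                              ≡⟨ cong (_+_ (sumTo m f)) (ℤP.+-identityˡ upper) ⟩
  sumTo m f + upper                                      ≡⟨ cong (_+_ (sumTo m f)) upper≡lower ⟩
  sumTo m f + sumTo m f                                  ≡⟨ i+i≡2*i (sumTo m f) ⟩
  + 2 * sumTo m f                                        ∎
  where
  upper = sumTo m (λ j → f (suc m ℕ.+ suc j))
  N≡m+[2+m] : suc (suc (m ℕ.+ m)) ≡ m ℕ.+ suc (suc m)
  N≡m+[2+m] = sym (trans (ℕP.+-suc m (suc m)) (cong suc (ℕP.+-suc m m)))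
  middle : f (suc m ℕ.+ 0) ≡ + 0
  middle = trans (cong (f ∘ suc) (ℕP.+-identityʳ m)) middle≡0
  upper≡lower : upper ≡ sumTo m f
  upper≡lower = trans (sumTo-cong m (λ j → cong (f ∘ suc) (ℕP.+-suc m j)))
                      (sumTo-mirrored-tail (suc (suc m)) m f pal)

n≡2[n/2]⊎n≡1+2[n/2] : ∀ n → n ≡ n / 2 ℕ.+ n / 2 ⊎ n ≡ suc (n / 2 ℕ.+ n / 2)
n≡2[n/2]⊎n≡1+2[n/2] 0 = inj₁ refl
n≡2[n/2]⊎n≡1+2[n/2] 1 = inj₂ refl
n≡2[n/2]⊎n≡1+2[n/2] (suc (suc n)) rewrite m/n≡1+[m∸n]/n {suc (suc n)} {2} (s≤s (s≤s z≤n)) with n≡2[n/2]⊎n≡1+2[n/2] n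
... | inj₁ e = inj₁ (cong suc (trans (cong suc e) (sym (ℕP.+-suc (n / 2) (n / 2)))))
... | inj₂ e = inj₂ (cong (suc ∘ suc) (trans e (sym (ℕP.+-suc (n / 2) (n / 2)))))

squares-palindromic : ∀ N (g : ℕ → ℤ) → Antipalindromic N g → Palindromic N (λ i → g i * g i)
squares-palindromic N g anti i i≤N =
  trans (cong₂ _*_ (anti i i≤N) (anti i i≤N)) (neg*neg (g i))
  where
  neg*neg : ∀ x → - x * - x ≡ x * x
  neg*neg = solve-∀

i≡-i⇒i≡0 : ∀ x → x ≡ - x → x ≡ + 0
i≡-i⇒i≡0 (+ zero)  _  = refl
i≡-i⇒i≡0 (+ suc n) ()
i≡-i⇒i≡0 -[1+ n ]  ()

antipalindromic-middle : ∀ m (g : ℕ → ℤ) → Antipalindromic (suc (suc (m ℕ.+ m))) g → g (suc m) ≡ + 0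
antipalindromic-middle m g anti = i≡-i⇒i≡0 (g (suc m)) (begin
  g (suc m)                              ≡⟨ cong g N∸[1+m]≡1+m ⟨
  g (suc (suc (m ℕ.+ m)) ∸ suc m)        ≡⟨ anti (suc m) (s≤s (ℕP.m≤n⇒m≤1+n (ℕP.m≤m+n m m))) ⟩
  - g (suc m)                            ∎)
  where
  N∸[1+m]≡1+m : suc (m ℕ.+ m) ∸ m ≡ suc m
  N∸[1+m]≡1+m = trans (cong (_∸ m) (sym (ℕP.+-suc m m))) (ℕP.m+n∸m≡n m (suc m))

sumTo-squares-antipalindromic : ∀ n (g : ℕ → ℤ) → Antipalindromic (suc n) g →
  sumTo (suc n) (λ i → g i * g i) ≡ + 2 * sumTo (n / 2) (λ i → g i * g i)
sumTo-squares-antipalindromic n g anti with n≡2[n/2]⊎n≡1+2[n/2] n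
... | inj₁ n≡m+m = begin
  sumTo (suc n) sq                        ≡⟨ cong (λ k → sumTo (suc k) sq) n≡m+m ⟩
  sumTo (suc (n / 2 ℕ.+ n / 2)) sq        ≡⟨ sumTo-palindromic-odd (n / 2) sq
                                               (squares-palindromic _ g (subst (λ k → Antipalindromic (suc k) g) n≡m+m anti)) ⟩
  + 2 * sumTo (n / 2) sq                  ∎
  where sq = λ i → g i * g i
... | inj₂ n≡1+m+m = begin
  sumTo (suc n) sq                        ≡⟨ cong (λ k → sumTo (suc k) sq) n≡1+m+m ⟩
  sumTo (suc (suc (n / 2 ℕ.+ n / 2))) sq  ≡⟨ sumTo-palindromic-even (n / 2) sq (squares-palindromic _ g anti′)
                                               (cong (λ x → x * x) (antipalindromic-middle (n / 2) g anti′)) ⟩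
  + 2 * sumTo (n / 2) sq                  ∎
  where
  sq = λ i → g i * g i
  anti′ = subst (λ k → Antipalindromic (suc k) g) n≡1+m+m anti

infixl 7 _⋆_

_⋆_ : (ℕ → ℤ) → (ℕ → ℤ) → ℕ → ℤ
(f ⋆ g) k = sumTo k (λ i → f i * g (k ∸ i))

shift : (ℕ → ℤ) → ℕ → ℤ
shift f zero    = + 0
shift f (suc k) = f k

-- As power series, shift f = x f and timesLinear c d f = (c + d x) f.
timesLinear : ℤ → ℤ → (ℕ → ℤ) → ℕ → ℤ
timesLinear c d f k = c * f k + d * shift f k

timesLinear-cong : ∀ c d {f g : ℕ → ℤ} → f ≗ g → timesLinear c d f ≗ timesLinear c d g
timesLinear-cong c d f≗g zero    = cong (λ x → c * x + d * + 0) (f≗g 0)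
timesLinear-cong c d f≗g (suc k) = cong₂ (λ x y → c * x + d * y) (f≗g (suc k)) (f≗g k)

⋆-cong : ∀ {f f′ g g′ : ℕ → ℤ} → f ≗ f′ → g ≗ g′ → f ⋆ g ≗ f′ ⋆ g′
⋆-cong f≗f′ g≗g′ k = sumTo-cong k (λ i → cong₂ _*_ (f≗f′ i) (g≗g′ (k ∸ i)))

shift-⋆ : ∀ (f g : ℕ → ℤ) → shift f ⋆ g ≗ shift (f ⋆ g)
shift-⋆ f g zero    = refl
shift-⋆ f g (suc k) = trans (sumTo-head k _) (ℤP.+-identityˡ _)

⋆-shift : ∀ (f g : ℕ → ℤ) → f ⋆ shift g ≗ shift (f ⋆ g)
⋆-shift f g zero    = ℤP.*-zeroʳ (f 0)
⋆-shift f g (suc k) = begin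
  sumTo k (λ i → f i * shift g (suc k ∸ i)) + f (suc k) * shift g (k ∸ k)
    ≡⟨ cong₂ _+_ (sumTo-cong≤ k (λ i i≤k → cong (λ j → f i * shift g j) (ℕP.+-∸-assoc 1 i≤k)))
                 (trans (cong (λ j → f (suc k) * shift g j) (ℕP.n∸n≡0 k)) (ℤP.*-zeroʳ (f (suc k)))) ⟩
  (f ⋆ g) k + + 0
    ≡⟨ ℤP.+-identityʳ _ ⟩
  (f ⋆ g) k ∎

timesLinear-⋆ : ∀ c d (f g : ℕ → ℤ) → timesLinear c d f ⋆ g ≗ timesLinear c d (f ⋆ g)
timesLinear-⋆ c d f g k = begin
  sumTo k (λ i → (c * f i + d * shift f i) * g (k ∸ i))
    ≡⟨ sumTo-cong k (λ i → distrib c d (f i) (shift f i) (g (k ∸ i))) ⟩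
  sumTo k (λ i → c * (f i * g (k ∸ i)) + d * (shift f i * g (k ∸ i)))
    ≡⟨ sumTo-linear k c d _ _ ⟩
  c * (f ⋆ g) k + d * (shift f ⋆ g) k
    ≡⟨ cong (λ x → c * (f ⋆ g) k + d * x) (shift-⋆ f g k) ⟩
  timesLinear c d (f ⋆ g) k ∎
  where
  distrib : ∀ c d x y z → (c * x + d * y) * z ≡ c * (x * z) + d * (y * z)
  distrib = solve-∀

⋆-timesLinear : ∀ c d (f g : ℕ → ℤ) → f ⋆ timesLinear c d g ≗ timesLinear c d (f ⋆ g)
⋆-timesLinear c d f g k = begin
  sumTo k (λ i → f i * (c * g (k ∸ i) + d * shift g (k ∸ i)))
    ≡⟨ sumTo-cong k (λ i → distrib c d (f i) (g (k ∸ i)) (shift g (k ∸ i))) ⟩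
  sumTo k (λ i → c * (f i * g (k ∸ i)) + d * (f i * shift g (k ∸ i)))
    ≡⟨ sumTo-linear k c d _ _ ⟩
  c * (f ⋆ g) k + d * (f ⋆ shift g) k
    ≡⟨ cong (λ x → c * (f ⋆ g) k + d * x) (⋆-shift f g k) ⟩
  timesLinear c d (f ⋆ g) k ∎
  where
  distrib : ∀ c d x y z → x * (c * y + d * z) ≡ c * (x * y) + d * (x * z)
  distrib = solve-∀

coeff-constant-⋆ : ∀ c (f : ℕ → ℤ) → coeff (c ∷ []) ⋆ f ≗ λ k → c * f k
coeff-constant-⋆ c f zero    = refl
coeff-constant-⋆ c f (suc k) = begin
  (coeff (c ∷ []) ⋆ f) (suc k)          ≡⟨ sumTo-head k _ ⟩
  c * f (suc k) + sumTo k (λ _ → + 0)    ≡⟨ cong (_+_ (c * f (suc k))) (sumTo-zero k) ⟩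
  c * f (suc k) + + 0                    ≡⟨ ℤP.+-identityʳ _ ⟩
  c * f (suc k)                          ∎

coeff-linear-⋆ : ∀ c d (f : ℕ → ℤ) → coeff (c ∷ d ∷ []) ⋆ f ≗ timesLinear c d f
coeff-linear-⋆ c d f zero    = sym (trans (cong (_+_ (c * f 0)) (ℤP.*-zeroʳ d)) (ℤP.+-identityʳ _))
coeff-linear-⋆ c d f (suc k) = trans (sumTo-head k _) (cong (_+_ (c * f (suc k))) (coeff-constant-⋆ d f k))

⋆-self-antipalindromic : ∀ n (g : ℕ → ℤ) → Antipalindromic (suc n) g →
                         (g ⋆ g) (suc n) ≡ - sumTo (suc n) (λ i → g i * g i)
⋆-self-antipalindromic n g anti = begin
  sumTo (suc n) (λ i → g i * g (suc n ∸ i))  ≡⟨ sumTo-cong≤ (suc n) mirrored-product ⟩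
  sumTo (suc n) (λ i → - (g i * g i))        ≡⟨ sumTo-neg (suc n) (λ i → g i * g i) ⟩
  - sumTo (suc n) (λ i → g i * g i)          ∎
  where
  mirrored-product : ∀ i → i ≤ suc n → g i * g (suc n ∸ i) ≡ - (g i * g i)
  mirrored-product i i≤1+n = trans (cong (_*_ (g i)) (anti i i≤1+n)) (sym (ℤP.neg-distribʳ-* (g i) (g i)))

binomZ-zero : ∀ z → binomZ z 0 ≡ + 1
binomZ-zero (+ n)    = refl
binomZ-zero -[1+ m ] = cong (λ t → + 1 * + (t C 0)) (ℕP.+-identityʳ m)

binomZ-pascal : ∀ z → binomZ (+ 1 + z) ≗ timesLinear (+ 1) (+ 1) (binomZ z)
binomZ-pascal z zero = begin
  binomZ (+ 1 + z) 0       ≡⟨ binomZ-zero (+ 1 + z) ⟩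
  + 1                      ≡⟨ sym (trans (ℤP.+-identityʳ _) (trans (ℤP.*-identityˡ _) (binomZ-zero z))) ⟩
  + 1 * binomZ z 0 + + 0   ∎
binomZ-pascal (+ n) (suc k) = begin
  + (suc n C suc k)                     ≡⟨ cong +_ (nCk+nC[k+1]≡[n+1]C[k+1] n k) ⟨
  + (n C k ℕ.+ n C suc k)               ≡⟨ ℤP.pos-+ (n C k) (n C suc k) ⟩
  + (n C k) + + (n C suc k)             ≡⟨ swap (+ (n C k)) (+ (n C suc k)) ⟩
  + 1 * + (n C suc k) + + 1 * + (n C k) ∎
  where
  swap : ∀ x y → x + y ≡ + 1 * y + + 1 * x
  swap = solve-∀
binomZ-pascal -[1+ zero ] (suc k) = begin
  + 0                                    ≡⟨ cancel ((- + 1) ^ k) ⟩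
  + 1 * ((- + 1) ^ suc k * + 1) + + 1 * ((- + 1) ^ k * + 1)
    ≡⟨ cong₂ (λ p q → + 1 * ((- + 1) ^ suc k * + p) + + 1 * ((- + 1) ^ k * + q)) (sym (nCn≡1 (suc k))) (sym (nCn≡1 k)) ⟩
  + 1 * binomZ -[1+ zero ] (suc k) + + 1 * binomZ -[1+ zero ] k ∎
  where
  cancel : ∀ s → + 0 ≡ + 1 * (- + 1 * s * + 1) + + 1 * (s * + 1)
  cancel = solve-∀
binomZ-pascal -[1+ suc m ] (suc k) = begin
  (- + 1) ^ suc k * + ((m ℕ.+ suc k) C suc k)
    ≡⟨ cong (λ t → (- + 1) ^ suc k * + (t C suc k)) (ℕP.+-suc m k) ⟩
  (- + 1) ^ suc k * + (P C suc k)
    ≡⟨ alternate ((- + 1) ^ k) (+ (P C k)) (+ (P C suc k)) ⟩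
  + 1 * ((- + 1) ^ suc k * (+ (P C k) + + (P C suc k))) + + 1 * ((- + 1) ^ k * + (P C k))
    ≡⟨ cong (λ t → + 1 * ((- + 1) ^ suc k * t) + + 1 * ((- + 1) ^ k * + (P C k))) pascal ⟩
  + 1 * binomZ -[1+ suc m ] (suc k) + + 1 * binomZ -[1+ suc m ] k ∎
  where
  P = suc m ℕ.+ k
  alternate : ∀ s x y → - + 1 * s * y ≡ + 1 * (- + 1 * s * (x + y)) + + 1 * (s * x)
  alternate = solve-∀
  pascal : + (P C k) + + (P C suc k) ≡ + ((suc m ℕ.+ suc k) C suc k)
  pascal = trans (sym (ℤP.pos-+ (P C k) _))
                 (cong +_ (trans (nCk+nC[k+1]≡[n+1]C[k+1] P k) (cong (λ t → suc t C suc k) (sym (ℕP.+-suc m k)))))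

⋆-identityˡ : ∀ (f : ℕ → ℤ) → binomZ (+ 0) ⋆ f ≗ f
⋆-identityˡ f zero    = ℤP.*-identityˡ (f 0)
⋆-identityˡ f (suc k) = begin
  (binomZ (+ 0) ⋆ f) (suc k)             ≡⟨ sumTo-head k _ ⟩
  + 1 * f (suc k) + sumTo k (λ _ → + 0)  ≡⟨ cong₂ _+_ (ℤP.*-identityˡ (f (suc k))) (sumTo-zero k) ⟩
  f (suc k) + + 0                        ≡⟨ ℤP.+-identityʳ _ ⟩
  f (suc k)                              ∎

module _ {A : Set} (F : ℤ → ℤ → A) (step : ∀ x y → F (+ 1 + x) y ≡ F x (+ 1 + y)) where

  private
    step-back : ∀ x y → F (+ 1 + x) (y - + 1) ≡ F (+ 0) (+ 1 + x + (y - + 1)) → F x y ≡ F (+ 0) (x + y)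
    step-back x y eq = begin
      F x y                              ≡⟨ cong (F x) (lower y) ⟨
      F x (+ 1 + (y - + 1))              ≡⟨ step x (y - + 1) ⟨
      F (+ 1 + x) (y - + 1)              ≡⟨ eq ⟩
      F (+ 0) (+ 1 + x + (y - + 1))      ≡⟨ cong (F (+ 0)) (regroup x y) ⟩
      F (+ 0) (x + y)                    ∎
      where
      lower : ∀ y → + 1 + (y - + 1) ≡ y
      lower = solve-∀
      regroup : ∀ x y → + 1 + x + (y - + 1) ≡ x + y
      regroup = solve-∀

  -- The negative clauses recurse structurally because + 1 + -[1+ suc m ] computes to -[1+ m ].
  diagonal-invariant : ∀ x y → F x y ≡ F (+ 0) (x + y)
  diagonal-invariant (+ zero)     y = cong (F (+ 0)) (sym (ℤP.+-identityˡ y))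
  diagonal-invariant (+ suc m)    y = begin
    F (+ suc m) y              ≡⟨ step (+ m) y ⟩
    F (+ m) (+ 1 + y)          ≡⟨ diagonal-invariant (+ m) (+ 1 + y) ⟩
    F (+ 0) (+ m + (+ 1 + y))  ≡⟨ cong (F (+ 0)) (regroup (+ m) y) ⟩
    F (+ 0) (+ suc m + y)      ∎
    where
    regroup : ∀ x y → x + (+ 1 + y) ≡ + 1 + x + y
    regroup = solve-∀
  diagonal-invariant -[1+ zero ]  y = step-back -[1+ zero ] y (diagonal-invariant (+ 0) (y - + 1))
  diagonal-invariant -[1+ suc m ] y = step-back -[1+ suc m ] y (diagonal-invariant -[1+ m ] (y - + 1))

vandermonde : ∀ x y → binomZ x ⋆ binomZ y ≗ binomZ (x + y)
vandermonde x y k = begin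
  (binomZ x ⋆ binomZ y) k              ≡⟨ diagonal-invariant (λ x y → (binomZ x ⋆ binomZ y) k) pascal-step x y ⟩
  (binomZ (+ 0) ⋆ binomZ (x + y)) k    ≡⟨ ⋆-identityˡ (binomZ (x + y)) k ⟩
  binomZ (x + y) k                     ∎
  where
  pascal-step : ∀ x y → (binomZ (+ 1 + x) ⋆ binomZ y) k ≡ (binomZ x ⋆ binomZ (+ 1 + y)) k
  pascal-step x y = begin
    (binomZ (+ 1 + x) ⋆ binomZ y) k                     ≡⟨ ⋆-cong {g = binomZ y} {g′ = binomZ y} (binomZ-pascal x) (λ _ → refl) k ⟩
    (timesLinear (+ 1) (+ 1) (binomZ x) ⋆ binomZ y) k   ≡⟨ timesLinear-⋆ (+ 1) (+ 1) (binomZ x) (binomZ y) k ⟩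
    timesLinear (+ 1) (+ 1) (binomZ x ⋆ binomZ y) k     ≡⟨ ⋆-timesLinear (+ 1) (+ 1) (binomZ x) (binomZ y) k ⟨
    (binomZ x ⋆ timesLinear (+ 1) (+ 1) (binomZ y)) k   ≡⟨ ⋆-cong {f = binomZ x} {f′ = binomZ x} (λ _ → refl) (binomZ-pascal y) k ⟨
    (binomZ x ⋆ binomZ (+ 1 + y)) k                     ∎

[k+1]*[n+1]C[k+1]≡[n+1]*nCk : ∀ n k → suc k ℕ.* (suc n C suc k) ≡ suc n ℕ.* (n C k)
[k+1]*[n+1]C[k+1]≡[n+1]*nCk zero    zero    = refl
[k+1]*[n+1]C[k+1]≡[n+1]*nCk zero    (suc k) = ℕP.*-zeroʳ (suc (suc k))
[k+1]*[n+1]C[k+1]≡[n+1]*nCk (suc n) zero    =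
  trans (ℕP.*-identityˡ _) (trans (nC1≡n (suc (suc n))) (sym (ℕP.*-identityʳ (suc (suc n)))))
[k+1]*[n+1]C[k+1]≡[n+1]*nCk (suc n) (suc k) = begin
  suc (suc k) ℕ.* (suc (suc n) C suc (suc k))
    ≡⟨ cong (suc (suc k) ℕ.*_) (nCk+nC[k+1]≡[n+1]C[k+1] (suc n) (suc k)) ⟨
  suc (suc k) ℕ.* (M C suc k ℕ.+ M C suc (suc k))
    ≡⟨ ℕP.*-distribˡ-+ (suc (suc k)) (M C suc k) _ ⟩
  (M C suc k ℕ.+ suc k ℕ.* (M C suc k)) ℕ.+ suc (suc k) ℕ.* (M C suc (suc k))
    ≡⟨ cong₂ (λ x y → (M C suc k ℕ.+ x) ℕ.+ y) ([k+1]*[n+1]C[k+1]≡[n+1]*nCk n k) ([k+1]*[n+1]C[k+1]≡[n+1]*nCk n (suc k)) ⟩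
  (M C suc k ℕ.+ M ℕ.* (n C k)) ℕ.+ M ℕ.* (n C suc k)
    ≡⟨ factor (M C suc k) M (n C k) (n C suc k) ⟩
  M C suc k ℕ.+ M ℕ.* (n C k ℕ.+ n C suc k)
    ≡⟨ cong (λ x → M C suc k ℕ.+ M ℕ.* x) (nCk+nC[k+1]≡[n+1]C[k+1] n k) ⟩
  suc M ℕ.* (M C suc k) ∎
  where
  M = suc n
  factor : ∀ a m x y → (a ℕ.+ m ℕ.* x) ℕ.+ m ℕ.* y ≡ a ℕ.+ m ℕ.* (x ℕ.+ y)
  factor = ℕSolver.solve-∀

central-binomial-ratio : ∀ n → suc n ℕ.* ((2 ℕ.* n) C suc n) ≡ n ℕ.* ((2 ℕ.* n) C n)
central-binomial-ratio n = ℕP.+-cancelʳ-≡ (suc n ℕ.* X) _ _ (begin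
  suc n ℕ.* Y ℕ.+ suc n ℕ.* X   ≡⟨ ℕP.*-distribˡ-+ (suc n) Y X ⟨
  suc n ℕ.* (Y ℕ.+ X)           ≡⟨ cong (suc n ℕ.*_) (trans (ℕP.+-comm Y X) (nCk+nC[k+1]≡[n+1]C[k+1] (2 ℕ.* n) n)) ⟩
  suc n ℕ.* (suc (2 ℕ.* n) C suc n)
                                ≡⟨ [k+1]*[n+1]C[k+1]≡[n+1]*nCk (2 ℕ.* n) n ⟩
  suc (2 ℕ.* n) ℕ.* X           ≡⟨ split n X ⟩
  n ℕ.* X ℕ.+ suc n ℕ.* X       ∎)
  where
  X = (2 ℕ.* n) C n
  Y = (2 ℕ.* n) C suc n
  split : ∀ n x → suc (2 ℕ.* n) ℕ.* x ≡ n ℕ.* x ℕ.+ suc n ℕ.* x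
  split = ℕSolver.solve-∀

catalan≡difference : ∀ n → + catalan n ≡ + ((2 ℕ.* n) C n) - + ((2 ℕ.* n) C suc n)
catalan≡difference n = begin
  + (X / suc n)                  ≡⟨ cong (λ x → + (x / suc n)) X≡[X∸Y]*[1+n] ⟩
  + ((X ∸ Y) ℕ.* suc n / suc n)  ≡⟨ cong +_ (m*n/n≡m (X ∸ Y) (suc n)) ⟩
  + (X ∸ Y)                      ≡⟨ ℤP.⊖-≥ Y≤X ⟨
  X ℤ.⊖ Y                        ≡⟨ ℤP.m-n≡m⊖n X Y ⟨
  + X - + Y                      ∎
  where
  X = (2 ℕ.* n) C n
  Y = (2 ℕ.* n) C suc n
  Y≤X : Y ≤ X
  Y≤X = ℕP.*-cancelˡ-≤ (suc n) (ℕP.≤-trans (ℕP.≤-reflexive (central-binomial-ratio n)) (ℕP.*-monoˡ-≤ X (ℕP.n≤1+n n)))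
  X≡[X∸Y]*[1+n] : X ≡ (X ∸ Y) ℕ.* suc n
  X≡[X∸Y]*[1+n] = sym (begin
    (X ∸ Y) ℕ.* suc n               ≡⟨ ℕP.*-distribʳ-∸ (suc n) X Y ⟩
    X ℕ.* suc n ∸ Y ℕ.* suc n       ≡⟨ cong₂ _∸_ (ℕP.*-comm X (suc n)) (trans (ℕP.*-comm Y (suc n)) (central-binomial-ratio n)) ⟩
    X ℕ.+ n ℕ.* X ∸ n ℕ.* X         ≡⟨ ℕP.m+n∸n≡m X (n ℕ.* X) ⟩
    X                               ∎)

binomZ-mirror : ∀ n i → i ≤ suc n → binomZ (+ n) (suc n ∸ i) ≡ shift (binomZ (+ n)) i
binomZ-mirror n zero    _         = cong +_ (k>n⇒nCk≡0 (ℕP.n<1+n n))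
binomZ-mirror n (suc i) (s≤s i≤n) = cong +_ (sym (nCk≡nC[n∸k] i≤n))

a-column : ∀ z → (λ k → a k z) ≗ timesLinear (+ 1) (- + 1) (binomZ z)
a-column z = coeff-linear-⋆ (+ 1) (- + 1) (binomZ z)

a-column-antipalindromic : ∀ n → Antipalindromic (suc n) (λ k → a k (+ n))
a-column-antipalindromic n i i≤1+n = begin
  a (suc n ∸ i) (+ n)                                   ≡⟨ a-column (+ n) (suc n ∸ i) ⟩
  + 1 * B (suc n ∸ i) + - + 1 * shift B (suc n ∸ i)     ≡⟨ cong₂ (λ x y → + 1 * x + - + 1 * y) (binomZ-mirror n i i≤1+n) shift-mirror ⟩
  + 1 * shift B i + - + 1 * B i                         ≡⟨ antisymmetry (B i) (shift B i) ⟩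
  - (+ 1 * B i + - + 1 * shift B i)                     ≡⟨ cong -_ (a-column (+ n) i) ⟨
  - a i (+ n)                                           ∎
  where
  B = binomZ (+ n)
  shift-mirror : shift B (suc n ∸ i) ≡ B i
  shift-mirror = sym (trans (cong B (sym (ℕP.m∸[m∸n]≡n i≤1+n)))
                            (binomZ-mirror n (suc n ∸ i) (ℕP.m∸n≤m (suc n) i)))
  antisymmetry : ∀ x y → + 1 * y + - + 1 * x ≡ - (+ 1 * x + - + 1 * y)
  antisymmetry = solve-∀

a-columns-⋆ : ∀ x y → (λ i → a i x) ⋆ (λ i → a i y) ≗
              timesLinear (+ 1) (- + 1) (timesLinear (+ 1) (- + 1) (binomZ (x + y)))
a-columns-⋆ x y k = begin
  ((λ i → a i x) ⋆ (λ i → a i y)) k       ≡⟨ ⋆-cong (a-column x) (a-column y) k ⟩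
  (Δ (binomZ x) ⋆ Δ (binomZ y)) k         ≡⟨ timesLinear-⋆ (+ 1) (- + 1) (binomZ x) (Δ (binomZ y)) k ⟩
  Δ (binomZ x ⋆ Δ (binomZ y)) k           ≡⟨ timesLinear-cong (+ 1) (- + 1) (⋆-timesLinear (+ 1) (- + 1) (binomZ x) (binomZ y)) k ⟩
  Δ (Δ (binomZ x ⋆ binomZ y)) k           ≡⟨ timesLinear-cong (+ 1) (- + 1) (timesLinear-cong (+ 1) (- + 1) (vandermonde x y)) k ⟩
  Δ (Δ (binomZ (x + y))) k                ∎
  where
  Δ = timesLinear (+ 1) (- + 1)

central-second-difference : ∀ n →
  timesLinear (+ 1) (- + 1) (timesLinear (+ 1) (- + 1) (binomZ (+ (2 ℕ.* n)))) (suc n)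
    ≡ - (+ 2 * (+ ((2 ℕ.* n) C n) - + ((2 ℕ.* n) C suc n)))
central-second-difference n = begin
  + 1 * (+ 1 * B (suc n) + - + 1 * B n) + - + 1 * (+ 1 * B n + - + 1 * shift B n)
    ≡⟨ cong (λ y → + 1 * (+ 1 * B (suc n) + - + 1 * B n) + - + 1 * (+ 1 * B n + - + 1 * y)) left-of-centre ⟩
  + 1 * (+ 1 * B (suc n) + - + 1 * B n) + - + 1 * (+ 1 * B n + - + 1 * B (suc n))
    ≡⟨ collect (B n) (B (suc n)) ⟩
  - (+ 2 * (B n - B (suc n))) ∎
  where
  B = binomZ (+ (2 ℕ.* n))
  n≤2n : n ≤ 2 ℕ.* n
  n≤2n = ℕP.m≤m+n n (n ℕ.+ 0)
  left-of-centre : shift B n ≡ B (suc n)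
  left-of-centre = begin
    shift B n                       ≡⟨ binomZ-mirror (2 ℕ.* n) n (ℕP.m≤n⇒m≤1+n n≤2n) ⟨
    B (suc (2 ℕ.* n) ∸ n)           ≡⟨ cong B (ℕP.+-∸-assoc 1 n≤2n) ⟩
    B (suc (2 ℕ.* n ∸ n))           ≡⟨ cong (B ∘ suc) (ℕP.m+n∸m≡n n (n ℕ.+ 0)) ⟩
    B (suc (n ℕ.+ 0))               ≡⟨ cong (B ∘ suc) (ℕP.+-identityʳ n) ⟩
    B (suc n)                       ∎
  collect : ∀ x y → + 1 * (+ 1 * y + - + 1 * x) + - + 1 * (+ 1 * x + - + 1 * y) ≡ - (+ 2 * (x - y))
  collect = solve-∀

a-columns-⋆-catalan : ∀ n x y → x + y ≡ + (2 ℕ.* n) →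
                      + 2 * + catalan n ≡ - ((λ i → a i x) ⋆ (λ i → a i y)) (suc n)
a-columns-⋆-catalan n x y x+y≡2n = begin
  + 2 * + catalan n                                ≡⟨ cong (+ 2 *_) (catalan≡difference n) ⟩
  + 2 * (+ ((2 ℕ.* n) C n) - + ((2 ℕ.* n) C suc n)) ≡⟨ ℤP.neg-involutive _ ⟨
  - - (+ 2 * (+ ((2 ℕ.* n) C n) - + ((2 ℕ.* n) C suc n)))
                                                   ≡⟨ cong -_ (central-second-difference n) ⟨
  - Δ (Δ (binomZ (+ (2 ℕ.* n)))) (suc n)           ≡⟨ cong (λ z → - Δ (Δ (binomZ z)) (suc n)) x+y≡2n ⟨
  - Δ (Δ (binomZ (x + y))) (suc n)                 ≡⟨ cong -_ (a-columns-⋆ x y (suc n)) ⟨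
  - ((λ i → a i x) ⋆ (λ i → a i y)) (suc n)        ∎
  where
  Δ = timesLinear (+ 1) (- + 1)

corollary8p4 : (n : ℕ) →
    (sumTo (ℕ.suc n) (λ i → a i (+ n) * a i (+ n)) ≡ + 2 * + catalan n)
    × (+ catalan n ≡ sumTo (n / 2) (λ i → a i (+ n) * a i (+ n)))
    × ((l : ℤ) → + 2 * + catalan n
         ≡ - sumTo (ℕ.suc n) (λ i → a i (+ n - l) * a (ℕ.suc n ℕ.∸ i) (+ n + l)))
corollary8p4 n = sum-of-squares , half-sum-of-squares , shifted-columns
  where
  column = λ i → a i (+ n)
  n+n≡2n : + n + + n ≡ + (2 ℕ.* n)
  n+n≡2n = trans (sym (ℤP.pos-+ n n)) (cong (λ m → + (n ℕ.+ m)) (sym (ℕP.+-identityʳ n)))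
  sum-of-squares : sumTo (suc n) (λ i → column i * column i) ≡ + 2 * + catalan n
  sum-of-squares = begin
    sumTo (suc n) (λ i → column i * column i)      ≡⟨ ℤP.neg-involutive _ ⟨
    - - sumTo (suc n) (λ i → column i * column i)  ≡⟨ cong -_ (⋆-self-antipalindromic n column (a-column-antipalindromic n)) ⟨
    - (column ⋆ column) (suc n)                    ≡⟨ a-columns-⋆-catalan n (+ n) (+ n) n+n≡2n ⟨
    + 2 * + catalan n                              ∎
  half-sum-of-squares : + catalan n ≡ sumTo (n / 2) (λ i → column i * column i)
  half-sum-of-squares = ℤP.*-cancelˡ-≡ (+ 2) _ _
    (trans (sym sum-of-squares) (sumTo-squares-antipalindromic n column (a-column-antipalindromic n)))
  shifted-columns : ∀ l → + 2 * + catalan n ≡ - ((λ i → a i (+ n - l)) ⋆ (λ i → a i (+ n + l))) (suc n)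
  shifted-columns l = a-columns-⋆-catalan n (+ n - l) (+ n + l) (trans (cancel (+ n) l) n+n≡2n)
    where
    cancel : ∀ m l → (m - l) + (m + l) ≡ m + m
    cancel = solve-∀
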